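{- The sequence of Fibonacci numbers $F=(n_F)_{n\ge1}$, with $1_F=2_F=1$ and $(n+2)_F=(n+1)_F+n_F$, is a cobweb tiling sequence. That is, it is admissible, and for all integers $1\le k\le n$, with $m=n-k+1$, the $F$-box $V_{m,n}=[k_F]\times[(k+1)_F]\times\cdots\times[n_F]$ admits a tiling.
   Context: Notation: $n_F!=n_F(n-1)_F\cdots1_F$, $0_F!=1$, and $\binom{n}{m}_F=\frac{n_F!}{m_F!(n-m)_F!}$. $F$ is admissible if $\binom{n}{m}_F\in\mathbb{N}\cup\{0\}$ for all integers $n\ge m\ge0$. Write $[s_F]=\{1,\dots,s_F\}$. A tiling of $V_{m,n}$ is a partition of $V_{m,n}$ into pairwise disjoint sub-boxes $A_1\times\cdots\times A_m$ such that $A_s\subseteq[(k+s-1)_F]$ and $|A_s|=(\sigma(s))_F$ for $s=1,\dots,m$, where $\sigma$ is a permutation of $\{1,\dots,m\}$ that may differ between sub-boxes. Equivalently, it is a partition of the maximal paths of the cobweb layer $\langle\Phi_k\to\Phi_n\rangle$, $\Phi_s=\{1,\dots,s_F\}$, into blocks $\sigma P_m$. A cobweb tiling sequence is an admissible sequence for which every such box has a tiling. -}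

module Defs where

open import Data.Nat using (ℕ; zero; suc; _+_; _*_; _∸_; _≤_)
open import Data.Nat.Divisibility using (_∣_)
open import Data.Fin using (Fin; toℕ)
open import Data.Fin.Subset using (Subset; _∈_; ∣_∣)
open import Data.Fin.Permutation using (Permutation′; _⟨$⟩ʳ_)
open import Data.Product using (Σ; ∃; _×_)
open import Relation.Binary.PropositionalEquality using (_≡_)

-- Fibonacci numbers: fib 1 = fib 2 = 1, fib (n+2) = fib (n+1) + fib n
-- (fib 0 = 0 is an auxiliary value; it never enters F-factorials).
fib : ℕ → ℕ
fib zero = zero
fib (suc zero) = suc zero
fib (suc (suc n)) = fib (suc n) + fib n

_!F_ : (ℕ → ℕ) → ℕ → ℕ
F !F zero = 1
F !F suc n = F (suc n) * (F !F n)

Admissible : (ℕ → ℕ) → Set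
Admissible F = ∀ n m → m ≤ n → ((F !F m) * (F !F (n ∸ m))) ∣ (F !F n)

-- Points of the F-box V_{m,n} with n = k + m - 1:
-- coordinate s (0-indexed, s = 0..m-1) lies in [(k+s)_F] (represented as Fin).
Point : (ℕ → ℕ) → ℕ → (m : ℕ) → Set
Point F k m = (s : Fin m) → Fin (F (k + toℕ s))

-- A sub-box A_1 × ... × A_m with A_s ⊆ [(k+s-1)_F] and |A_s| = (σ(s))_F
-- for some permutation σ of {1,..,m} (0-indexed here: σ(s)+1).
record Tile (F : ℕ → ℕ) (k m : ℕ) : Set where
  field
    σ     : Permutation′ m
    A     : (s : Fin m) → Subset (F (k + toℕ s))
    sizes : (s : Fin m) → ∣ A s ∣ ≡ F (suc (toℕ (σ ⟨$⟩ʳ s)))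

_∈Tile_ : {F : ℕ → ℕ} {k m : ℕ} → Point F k m → Tile F k m → Set
_∈Tile_ {m = m} p t = (s : Fin m) → p s ∈ Tile.A t s

record Tiling (F : ℕ → ℕ) (k m : ℕ) : Set where
  field
    count    : ℕ
    tile     : Fin count → Tile F k m
    covers   : (p : Point F k m) → ∃ λ i → p ∈Tile tile i
    disjoint : (p : Point F k m) (i j : Fin count) →
               p ∈Tile tile i → p ∈Tile tile j → i ≡ j

CobwebTilingSequence : (ℕ → ℕ) → Set
CobwebTilingSequence F =
  Admissible F × (∀ k n → 1 ≤ k → k ≤ n → Tiling F k (suc (n ∸ k)))

-- The addition formula fib (k + m + 1) = fib (k + 1) fib (m + 1) + fib m fib k cuts the longest
-- side of the box fib (k + 1) × ⋯ × fib (k + m + 1) into fib (k + 1) slabs of thickness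
-- fib (m + 1) and fib m slabs of thickness fib k. A slab of the first kind is a prism over the
-- box fib (k + 1) × ⋯ × fib (k + m), one of the second kind is the box fib k × ⋯ × fib (k + m)
-- with its coordinates rotated, so both are tiled by induction on (k, m). The same formula
-- gives a Pascal-type recurrence for the F-binomial coefficients, whence admissibility.
module Submission where

open import Defs
open import Data.Nat
open import Data.Nat.Properties
open import Data.Nat.Divisibility using (divides)
open import Data.Nat.Tactic.RingSolver using (solve-∀)
open import Data.Fin using (Fin; zero; suc; toℕ; fromℕ; punchIn; splitAt; join)
open import Data.Fin.Properties using (toℕ-fromℕ; toℕ<n; splitAt-join; join-splitAt)
open import Data.Fin.Permutation as Perm
  using (Permutation′; _⟨$⟩ʳ_; _⟨$⟩ˡ_; _∘ₚ_; inverseˡ; inverseʳ; lift₀; insert; insert-punchIn)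
open import Data.Fin.Subset using (Subset; inside; outside; ∣_∣; _∈_)
open import Data.Vec as Vec using (here; there)
open import Data.Vec.Functional using (Vector; _∷_; tail)
open import Data.Product using (∃; _×_; _,_; proj₁; proj₂)
open import Data.Sum using (_⊎_; inj₁; inj₂)
open import Data.Empty using (⊥-elim)
open import Function using (_∘_)
open import Relation.Nullary using (yes; no)
open import Relation.Binary.PropositionalEquality

fib-+ : ∀ x y → fib (suc (x + y)) ≡ fib (suc x) * fib (suc y) + fib x * fib y
fib-+ zero    y = sym (trans (+-identityʳ _) (*-identityˡ _))
fib-+ (suc x) y = begin
  fib (suc (suc x + y))
    ≡⟨ cong (fib ∘ suc) (sym (+-suc x y)) ⟩
  fib (suc (x + suc y))
    ≡⟨ fib-+ x (suc y) ⟩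
  fib (suc x) * (fib (suc y) + fib y) + fib x * fib (suc y)
    ≡⟨ regroup (fib (suc x)) (fib x) (fib (suc y)) (fib y) ⟩
  (fib (suc x) + fib x) * fib (suc y) + fib (suc x) * fib y ∎
  where
  open ≡-Reasoning
  regroup : ∀ a b c d → a * (c + d) + b * c ≡ (a + b) * c + a * d
  regroup = solve-∀

fibonomial : ℕ → ℕ → ℕ
fibonomial zero    b       = 1
fibonomial (suc a) zero    = 1
fibonomial (suc a) (suc b) =
  fib (suc (suc b)) * fibonomial a (suc b) + fib a * fibonomial (suc a) b

fibonomial-* : ∀ a b → fibonomial a b * (fib !F a * fib !F b) ≡ fib !F (a + b)
fibonomial-* zero    b       = trans (*-identityˡ _) (*-identityˡ _)
fibonomial-* (suc a) zero    =
  trans (*-identityˡ _) (trans (*-identityʳ _) (cong (fib !F_) (sym (+-identityʳ (suc a)))))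
fibonomial-* (suc a) (suc b) = begin
  (fib (2 + b) * fibonomial a (suc b) + fib a * fibonomial (suc a) b)
    * (fib !F suc a * fib !F suc b)
    ≡⟨ regroup (fib (2 + b)) (fibonomial a (suc b)) (fib a) (fibonomial (suc a) b)
               (fib (suc a)) (fib !F a) (fib (suc b)) (fib !F b) ⟩
  fib (suc a) * fib (2 + b) * (fibonomial a (suc b) * (fib !F a * fib !F suc b))
    + fib a * fib (suc b) * (fibonomial (suc a) b * (fib !F suc a * fib !F b))
    ≡⟨ cong₂ (λ u v → fib (suc a) * fib (2 + b) * u + fib a * fib (suc b) * v)
             (fibonomial-* a (suc b))
             (trans (fibonomial-* (suc a) b) (cong (fib !F_) (sym (+-suc a b)))) ⟩
  fib (suc a) * fib (2 + b) * N + fib a * fib (suc b) * N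
    ≡⟨ sym (*-distribʳ-+ N (fib (suc a) * fib (2 + b)) (fib a * fib (suc b))) ⟩
  (fib (suc a) * fib (2 + b) + fib a * fib (suc b)) * N
    ≡⟨ cong (_* N) (sym (fib-+ a (suc b))) ⟩
  fib !F (suc a + suc b) ∎
  where
  open ≡-Reasoning
  N : ℕ
  N = fib !F (a + suc b)
  regroup : ∀ f B₁ g B₂ a₁ a! b₁ b! →
            (f * B₁ + g * B₂) * (a₁ * a! * (b₁ * b!))
              ≡ a₁ * f * (B₁ * (a! * (b₁ * b!))) + g * b₁ * (B₂ * (a₁ * a! * b!))
  regroup = solve-∀

fib-admissible : Admissible fib
fib-admissible n m m≤n = divides (fibonomial (n ∸ m) m) (sym (begin
  fibonomial (n ∸ m) m * (fib !F m * fib !F (n ∸ m))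
    ≡⟨ cong (fibonomial (n ∸ m) m *_) (*-comm (fib !F m) _) ⟩
  fibonomial (n ∸ m) m * (fib !F (n ∸ m) * fib !F m)
    ≡⟨ fibonomial-* (n ∸ m) m ⟩
  fib !F (n ∸ m + m)
    ≡⟨ cong (fib !F_) (m∸n+n≡m m≤n) ⟩
  fib !F n ∎))
  where open ≡-Reasoning

infix 4 _∈[_,+_⟩

_∈[_,+_⟩ : ℕ → ℕ → ℕ → Set
x ∈[ lo ,+ w ⟩ = lo ≤ x × x < lo + w

+-∈[,+⟩ : ∀ a {y lo w} → y ∈[ lo ,+ w ⟩ → a + y ∈[ a + lo ,+ w ⟩
+-∈[,+⟩ a (lo≤y , y<hi) =
  +-monoʳ-≤ a lo≤y , ≤-trans (+-monoʳ-< a y<hi) (≤-reflexive (sym (+-assoc a _ _)))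

+-∈[,+⟩⁻ : ∀ a {y lo w} → a + y ∈[ a + lo ,+ w ⟩ → y ∈[ lo ,+ w ⟩
+-∈[,+⟩⁻ a (lo≤y , y<hi) =
  +-cancelˡ-≤ a _ _ lo≤y , +-cancelˡ-< a _ _ (≤-trans y<hi (≤-reflexive (+-assoc a _ _)))

interval : (n lo w : ℕ) → Subset n
interval zero    lo       w       = Vec.[]
interval (suc n) (suc lo) w       = outside Vec.∷ interval n lo w
interval (suc n) zero     zero    = outside Vec.∷ interval n zero zero
interval (suc n) zero     (suc w) = inside Vec.∷ interval n zero w

∣interval∣ : ∀ n lo w → lo + w ≤ n → ∣ interval n lo w ∣ ≡ w
∣interval∣ zero    zero     zero    _          = refl
∣interval∣ (suc n) (suc lo) w       (s≤s fits) = ∣interval∣ n lo w fits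
∣interval∣ (suc n) zero     zero    _          = ∣interval∣ n zero zero z≤n
∣interval∣ (suc n) zero     (suc w) (s≤s fits) = cong suc (∣interval∣ n zero w fits)

∈interval⁺ : ∀ n lo w (x : Fin n) → toℕ x ∈[ lo ,+ w ⟩ → x ∈ interval n lo w
∈interval⁺ (suc n) (suc lo) w       (suc x) (s≤s l , s≤s u) = there (∈interval⁺ n lo w x (l , u))
∈interval⁺ (suc n) zero     (suc w) zero    _               = here
∈interval⁺ (suc n) zero     (suc w) (suc x) (_ , s≤s u)     = there (∈interval⁺ n zero w x (z≤n , u))

∈interval⁻ : ∀ n lo w (x : Fin n) → x ∈ interval n lo w → toℕ x ∈[ lo ,+ w ⟩
∈interval⁻ (suc n) (suc lo) w       (suc x) (there x∈) =
  let l , u = ∈interval⁻ n lo w x x∈ in s≤s l , s≤s u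
∈interval⁻ (suc n) zero     zero    (suc x) (there x∈) =
  ⊥-elim (n≮0 (proj₂ (∈interval⁻ n zero zero x x∈)))
∈interval⁻ (suc n) zero     (suc w) zero    here       = z≤n , s≤s z≤n
∈interval⁻ (suc n) zero     (suc w) (suc x) (there x∈) = z≤n , s≤s (proj₂ (∈interval⁻ n zero w x x∈))

-- A brick in the box [0, d₀) × ⋯ × [0, dₘ₋₁) of ℕᵐ: the product of the intervals
-- [corner s, corner s + z (σ s)), so its side lengths are a permutation of z.
record Brick (m : ℕ) (d z : Vector ℕ m) : Set where
  field
    σ      : Permutation′ m
    corner : Vector ℕ m
    fits   : ∀ s → corner s + z (σ ⟨$⟩ʳ s) ≤ d s

open Brick

infix 4 _∈Brick_ _∈Box_

_∈Brick_ : ∀ {m d z} → Vector ℕ m → Brick m d z → Set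
_∈Brick_ {z = z} p b = ∀ s → p s ∈[ corner b s ,+ z (σ b ⟨$⟩ʳ s) ⟩

_∈Box_ : ∀ {m} → Vector ℕ m → Vector ℕ m → Set
p ∈Box d = ∀ s → p s < d s

record IsBrickTiling {m d z} {I : Set} (brick : I → Brick m d z) : Set where
  field
    covers   : ∀ p → p ∈Box d → ∃ λ i → p ∈Brick brick i
    disjoint : ∀ p i j → p ∈Brick brick i → p ∈Brick brick j → i ≡ j

record BrickTiling (m : ℕ) (d z : Vector ℕ m) : Set where
  field
    count         : ℕ
    brick         : Fin count → Brick m d z
    isBrickTiling : IsBrickTiling brick

open IsBrickTiling
open BrickTiling

IsBrickTiling-reindex : ∀ {m d z} {I J : Set} {brick : I → Brick m d z}
                        (f : J → I) (g : I → J) → (∀ i → f (g i) ≡ i) → (∀ j → g (f j) ≡ j) →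
                        IsBrickTiling brick → IsBrickTiling (brick ∘ f)
IsBrickTiling-reindex {brick = brick} f g f∘g g∘f T = record
  { covers   = λ p p∈ → let i , p∈i = covers T p p∈
                        in g i , subst (λ i → p ∈Brick brick i) (sym (f∘g i)) p∈i
  ; disjoint = λ p i j p∈i p∈j →
      trans (sym (g∘f i)) (trans (cong g (disjoint T p (f i) (f j) p∈i p∈j)) (g∘f j))
  }

emptyBoxTiling : ∀ {m d z} (s : Fin m) → d s ≡ 0 → BrickTiling m d z
emptyBoxTiling s d≡0 = record
  { count         = 0
  ; brick         = λ ()
  ; isBrickTiling = record
    { covers   = λ p p∈ → ⊥-elim (n≮0 (subst (_ <_) d≡0 (p∈ s)))
    ; disjoint = λ _ () }
  }

pointTiling : ∀ {d z} → BrickTiling 0 d z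
pointTiling = record
  { count         = 1
  ; brick         = λ _ → record { σ = Perm.id ; corner = λ () ; fits = λ () }
  ; isBrickTiling = record
    { covers   = λ _ _ → zero , λ ()
    ; disjoint = λ { _ zero zero _ _ → refl } }
  }

permuteSides : ∀ {m d d′ z} (π : Permutation′ m) → (∀ s → d′ (π ⟨$⟩ʳ s) ≡ d s) →
               BrickTiling m d z → BrickTiling m d′ z
permuteSides {m} {d} {d′} {z} π d′∘π≗d T = record
  { count         = count T
  ; brick         = move ∘ brick T
  ; isBrickTiling = record
    { covers   = λ p p∈ → let i , p∘π∈i = covers (isBrickTiling T) (p ∘π) (∘π-∈Box p p∈)
                          in i , ∈move⁺ p (brick T i) p∘π∈i
    ; disjoint = λ p i j p∈i p∈j →
        disjoint (isBrickTiling T) (p ∘π) i j (∈move⁻ p (brick T i) p∈i) (∈move⁻ p (brick T j) p∈j) }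
  }
  where
  _∘π : Vector ℕ m → Vector ℕ m
  p ∘π = p ∘ (π ⟨$⟩ʳ_)
  move : Brick m d z → Brick m d′ z
  move b = record
    { σ      = Perm.flip π ∘ₚ σ b
    ; corner = corner b ∘ (π ⟨$⟩ˡ_)
    ; fits   = λ s → ≤-trans (fits b (π ⟨$⟩ˡ s))
                             (≤-reflexive (trans (sym (d′∘π≗d _)) (cong d′ (inverseʳ π)))) }
  ∘π-∈Box : ∀ p → p ∈Box d′ → p ∘π ∈Box d
  ∘π-∈Box p p∈ s = subst (_ <_) (d′∘π≗d s) (p∈ (π ⟨$⟩ʳ s))
  ∈move⁻ : ∀ p b → p ∈Brick move b → p ∘π ∈Brick b
  ∈move⁻ p b p∈ s =
    subst (λ u → p (π ⟨$⟩ʳ s) ∈[ corner b u ,+ z (σ b ⟨$⟩ʳ u) ⟩) (inverseˡ π) (p∈ (π ⟨$⟩ʳ s))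
  ∈move⁺ : ∀ p b → p ∘π ∈Brick b → p ∈Brick move b
  ∈move⁺ p b p∘π∈ s =
    subst (λ u → p u ∈[ corner b (π ⟨$⟩ˡ s) ,+ z (σ b ⟨$⟩ʳ (π ⟨$⟩ˡ s)) ⟩) (inverseʳ π) (p∘π∈ (π ⟨$⟩ˡ s))

permuteSizes : ∀ {m d z z′} (ρ : Permutation′ m) → (∀ x → z′ (ρ ⟨$⟩ʳ x) ≡ z x) →
               BrickTiling m d z → BrickTiling m d z′
permuteSizes {m} {d} {z} {z′} ρ z′∘ρ≗z T = record
  { count         = count T
  ; brick         = resize ∘ brick T
  ; isBrickTiling = record
    { covers   = λ p p∈ → let i , p∈i = covers (isBrickTiling T) p p∈
                          in i , ∈resize⁺ p (brick T i) p∈i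
    ; disjoint = λ p i j p∈i p∈j →
        disjoint (isBrickTiling T) p i j (∈resize⁻ p (brick T i) p∈i) (∈resize⁻ p (brick T j) p∈j) }
  }
  where
  resize : Brick m d z → Brick m d z′
  resize b = record
    { σ      = σ b ∘ₚ ρ
    ; corner = corner b
    ; fits   = λ s → subst (λ w → corner b s + w ≤ d s) (sym (z′∘ρ≗z (σ b ⟨$⟩ʳ s))) (fits b s) }
  ∈resize⁺ : ∀ p b → p ∈Brick b → p ∈Brick resize b
  ∈resize⁺ p b p∈ s = subst (λ w → p s ∈[ corner b s ,+ w ⟩) (sym (z′∘ρ≗z (σ b ⟨$⟩ʳ s))) (p∈ s)
  ∈resize⁻ : ∀ p b → p ∈Brick resize b → p ∈Brick b
  ∈resize⁻ p b p∈ s = subst (λ w → p s ∈[ corner b s ,+ w ⟩) (z′∘ρ≗z (σ b ⟨$⟩ʳ s)) (p∈ s)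

prism : ∀ {m d z} w → BrickTiling m d z → BrickTiling (suc m) (w ∷ d) (w ∷ z)
prism {m} {d} {z} w T = record
  { count         = count T
  ; brick         = extrude ∘ brick T
  ; isBrickTiling = record
    { covers   = λ p p∈ → let i , tail∈i = covers (isBrickTiling T) (tail p) (p∈ ∘ suc)
                          in i , λ { zero → z≤n , p∈ zero ; (suc s) → tail∈i s }
    ; disjoint = λ p i j p∈i p∈j → disjoint (isBrickTiling T) (tail p) i j (p∈i ∘ suc) (p∈j ∘ suc) }
  }
  where
  extrude : Brick m d z → Brick (suc m) (w ∷ d) (w ∷ z)
  extrude b = record
    { σ      = lift₀ (σ b)
    ; corner = 0 ∷ corner b
    ; fits   = λ { zero → ≤-refl ; (suc s) → fits b s } }

stack : ∀ {m d z a b} → BrickTiling (suc m) (a ∷ d) z → BrickTiling (suc m) (b ∷ d) z →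
        BrickTiling (suc m) (a + b ∷ d) z
stack {m} {d} {z} {a} {b} T U = record
  { count         = count T + count U
  ; brick         = brick′ ∘ splitAt (count T)
  ; isBrickTiling = IsBrickTiling-reindex {brick = brick′}
                      (splitAt (count T)) (join (count T) (count U))
                      (splitAt-join (count T) (count U)) (join-splitAt (count T) (count U))
                      (record { covers = covers′ ; disjoint = disjoint′ })
  }
  where
  widen : Brick (suc m) (a ∷ d) z → Brick (suc m) (a + b ∷ d) z
  widen t = record
    { σ      = σ t
    ; corner = corner t
    ; fits   = λ { zero → ≤-trans (fits t zero) (m≤m+n a b) ; (suc s) → fits t (suc s) } }
  shift : Brick (suc m) (b ∷ d) z → Brick (suc m) (a + b ∷ d) z
  shift t = record
    { σ      = σ t
    ; corner = a + corner t zero ∷ tail (corner t)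
    ; fits   = λ { zero    → ≤-trans (≤-reflexive (+-assoc a _ _)) (+-monoʳ-≤ a (fits t zero))
                 ; (suc s) → fits t (suc s) } }
  brick′ : Fin (count T) ⊎ Fin (count U) → Brick (suc m) (a + b ∷ d) z
  brick′ (inj₁ i) = widen (brick T i)
  brick′ (inj₂ j) = shift (brick U j)
  unshift : Vector ℕ (suc m) → Vector ℕ (suc m)
  unshift p = p zero ∸ a ∷ tail p
  ∈widen⇒<a : ∀ p t → p ∈Brick widen t → p zero < a
  ∈widen⇒<a p t p∈ = <-≤-trans (proj₂ (p∈ zero)) (fits t zero)
  ∈shift⁻ : ∀ p t → p ∈Brick shift t → a ≤ p zero × unshift p ∈Brick t
  ∈shift⁻ p t p∈ = a≤p₀ , λ
    { zero    → +-∈[,+⟩⁻ a (subst (_∈[ _ ,+ _ ⟩) (sym (m+[n∸m]≡n a≤p₀)) (p∈ zero))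
    ; (suc s) → p∈ (suc s) }
    where a≤p₀ = ≤-trans (m≤m+n a _) (proj₁ (p∈ zero))
  ∈shift⁺ : ∀ p t → a ≤ p zero → unshift p ∈Brick t → p ∈Brick shift t
  ∈shift⁺ p t a≤p₀ q∈ zero    = subst (_∈[ _ ,+ _ ⟩) (m+[n∸m]≡n a≤p₀) (+-∈[,+⟩ a (q∈ zero))
  ∈shift⁺ p t a≤p₀ q∈ (suc s) = q∈ (suc s)
  covers′ : ∀ p → p ∈Box (a + b ∷ d) → ∃ λ i → p ∈Brick brick′ i
  covers′ p p∈ with p zero <? a
  ... | yes p₀<a = let i , p∈i = covers (isBrickTiling T) p λ { zero → p₀<a ; (suc s) → p∈ (suc s) }
                   in inj₁ i , p∈i
  ... | no  p₀≮a = let j , q∈j = covers (isBrickTiling U) (unshift p) q∈Box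
                   in inj₂ j , ∈shift⁺ p (brick U j) a≤p₀ q∈j
    where
    a≤p₀ = ≮⇒≥ p₀≮a
    q∈Box : unshift p ∈Box (b ∷ d)
    q∈Box zero    = +-cancelˡ-< a _ _ (subst (_< a + b) (sym (m+[n∸m]≡n a≤p₀)) (p∈ zero))
    q∈Box (suc s) = p∈ (suc s)
  disjoint′ : ∀ p i j → p ∈Brick brick′ i → p ∈Brick brick′ j → i ≡ j
  disjoint′ p (inj₁ i) (inj₁ j) p∈i p∈j = cong inj₁ (disjoint (isBrickTiling T) p i j p∈i p∈j)
  disjoint′ p (inj₁ i) (inj₂ j) p∈i p∈j =
    ⊥-elim (<⇒≱ (∈widen⇒<a p (brick T i) p∈i) (proj₁ (∈shift⁻ p (brick U j) p∈j)))
  disjoint′ p (inj₂ i) (inj₁ j) p∈i p∈j =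
    ⊥-elim (<⇒≱ (∈widen⇒<a p (brick T j) p∈j) (proj₁ (∈shift⁻ p (brick U i) p∈i)))
  disjoint′ p (inj₂ i) (inj₂ j) p∈i p∈j = cong inj₂ (disjoint (isBrickTiling U) (unshift p) i j
    (proj₂ (∈shift⁻ p (brick U i) p∈i)) (proj₂ (∈shift⁻ p (brick U j) p∈j)))

stackCopies : ∀ {m d z a} c → BrickTiling (suc m) (a ∷ d) z → BrickTiling (suc m) (c * a ∷ d) z
stackCopies zero    T = emptyBoxTiling zero refl
stackCopies (suc c) T = stack T (stackCopies c T)

toTiling : ∀ {F k m} → BrickTiling m (λ s → F (k + toℕ s)) (λ x → F (suc (toℕ x))) → Tiling F k m
toTiling {F} {k} {m} T = record
  { count    = count T
  ; tile     = tile
  ; covers   = λ p → let i , p∈i = covers (isBrickTiling T) (toℕ ∘ p) (toℕ<n ∘ p)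
                     in i , λ s → ∈interval⁺ _ _ _ (p s) (p∈i s)
  ; disjoint = λ p i j p∈i p∈j → disjoint (isBrickTiling T) (toℕ ∘ p) i j
                                   (λ s → ∈interval⁻ _ _ _ (p s) (p∈i s))
                                   (λ s → ∈interval⁻ _ _ _ (p s) (p∈j s))
  }
  where
  tile : Fin (count T) → Tile F k m
  tile i = record
    { σ     = σ (brick T i)
    ; A     = λ s → interval _ (corner (brick T i) s) (F (suc (toℕ (σ (brick T i) ⟨$⟩ʳ s))))
    ; sizes = λ s → ∣interval∣ _ _ _ (fits (brick T i) s)
    }

rotate : ∀ m → Permutation′ (suc m)
rotate m = insert zero (fromℕ m) Perm.id

toℕ-punchIn-fromℕ : ∀ {m} (t : Fin m) → toℕ (punchIn (fromℕ m) t) ≡ toℕ t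
toℕ-punchIn-fromℕ zero    = refl
toℕ-punchIn-fromℕ (suc t) = cong suc (toℕ-punchIn-fromℕ t)

rotate-ascending : ∀ {m} (f : ℕ → ℕ) (s : Fin (suc m)) →
                   f (toℕ (rotate m ⟨$⟩ʳ s)) ≡ (f m ∷ f ∘ toℕ) s
rotate-ascending {m} f zero    = cong f (toℕ-fromℕ m)
rotate-ascending {m} f (suc t) =
  cong f (trans (cong toℕ (insert-punchIn zero (fromℕ m) Perm.id t)) (toℕ-punchIn-fromℕ t))

fibBox : ℕ → (m : ℕ) → Vector ℕ m
fibBox k m s = fib (k + toℕ s)

fibBrick : (m : ℕ) → Vector ℕ m
fibBrick m x = fib (suc (toℕ x))

fibTiling : ∀ k m → BrickTiling m (fibBox k m) (fibBrick m)
fibTiling k       zero    = pointTiling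
fibTiling zero    (suc m) = emptyBoxTiling zero refl
fibTiling (suc k) (suc m) = permuteSides (rotate m) sides (stack
  (stackCopies (fib (suc k))
    (permuteSizes (rotate m) (rotate-ascending (fib ∘ suc)) (prism (fib (suc m)) (fibTiling (suc k) m))))
  (stackCopies (fib m) (permuteSides Perm.id lowered (fibTiling k (suc m)))))
  where
  lowered : ∀ s → (fib k ∷ fibBox (suc k) m) s ≡ fibBox k (suc m) s
  lowered zero    = cong fib (sym (+-identityʳ k))
  lowered (suc t) = cong fib (sym (+-suc k (toℕ t)))
  longest : ∀ s → (fib (suc k + m) ∷ fibBox (suc k) m) s
                ≡ (fib (suc k) * fib (suc m) + fib m * fib k ∷ fibBox (suc k) m) s
  longest zero    = trans (fib-+ k m) (cong (fib (suc k) * fib (suc m) +_) (*-comm (fib k) (fib m)))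
  longest (suc t) = refl
  sides : ∀ s → fibBox (suc k) (suc m) (rotate m ⟨$⟩ʳ s)
              ≡ (fib (suc k) * fib (suc m) + fib m * fib k ∷ fibBox (suc k) m) s
  sides s = trans (rotate-ascending (λ i → fib (suc k + i)) s) (longest s)

mainTheorem8 : CobwebTilingSequence fib
mainTheorem8 = fib-admissible , λ k n _ _ → toTiling (fibTiling k (suc (n ∸ k)))
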